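{- Let $\mathbf{L}$ be a set of data words, $\mathcal{I}\in\mathsf{FCons}(\mathbb{Z})$, $n\ge1$ and $k\ge0$. Then $\mathbf{L}$ is not definable in $\mathrm{TPTL}^{n,\mathcal{I}}_k$ (no formula of this set is satisfied by exactly the data words in $\mathbf{L}$) if and only if there exist $w_0\in\mathbf{L}$ and $w_1\notin\mathbf{L}$ such that Duplicator has a winning strategy in $\mathrm{TG}^{n,\mathcal{I}}_k(w_0,0,\nu^{w_0}_0,w_1,0,\nu^{w_1}_0)$, where $\nu^{w}_0$ maps every register to the first data value of $w$.
   Context: Data words: infinite sequences $w=(P_0,d_0)(P_1,d_1)\dots$, $P_i\subseteq\mathcal{P}$ ($\mathcal{P}$ finite), $d_i\in\mathbb{N}$; write $d^w_i$. Intervals have endpoints in $\mathbb{Z}\cup\{\pm\infty\}$. TPTL formulas: $\varphi::=p\mid x\in I\mid\neg\varphi\mid\varphi_1\wedge\varphi_2\mid\varphi_1\mathsf{U}\varphi_2\mid x.\varphi$; a register valuation is $\nu:X\to\mathbb{N}$; $(w,i,\nu)\models p$ iff $p\in P_i$; $(w,i,\nu)\models x\in I$ iff $d_i-\nu(x)\in I$; $(w,i,\nu)\models x.\varphi$ iff $(w,i,\nu[x\mapsto d_i])\models\varphi$; $(w,i,\nu)\models\varphi_1\mathsf{U}\varphi_2$ iff there is $j>i$ with $(w,j,\nu)\models\varphi_2$ and $(w,k,\nu)\models\varphi_1$ for all $i<k<j$. $w\models\varphi$ iff $(w,0,\nu^w_0)\models\varphi$. Until rank: $\mathrm{urk}(p)=\mathrm{urk}(x\in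 I)=0$, $\mathrm{urk}(\neg\varphi)=\mathrm{urk}(x.\varphi)=\mathrm{urk}(\varphi)$, $\mathrm{urk}(\varphi_1\wedge\varphi_2)=\max$, $\mathrm{urk}(\varphi_1\mathsf{U}\varphi_2)=\max+1$. $\mathsf{FCons}(\mathbb{Z})$: sets $S\cup\{\pm\infty\}$, $S\subseteq\mathbb{Z}$ finite. $\mathrm{TPTL}^{n,\mathcal{I}}_k$: TPTL formulas of until rank $\le k$, registers among $x_1,\dots,x_n$, all interval endpoints in constraints $x\in I$ in $\mathcal{I}$. $(i_0,\nu_0)$ and $(i_1,\nu_1)$ agree in the atomic formulas if $(w_0,i_0,\nu_0)$, $(w_1,i_1,\nu_1)$ satisfy the same $p\in\mathcal{P}$ and the same $x\in I$ with $x\in\{x_1,\dots,x_n\}$, endpoints of $I$ in $\mathcal{I}$. Game $\mathrm{TG}^{n,\mathcal{I}}_k(w_0,i_0,\nu_0,w_1,i_1,\nu_1)$: if $k=0$, Spoiler wins iff the pairs do not agree in the atomic formulas. If $k>0$: (1) if they do not agree, Spoiler wins; otherwise Spoiler chooses $Y\subseteq\{x_1,\dots,x_n\}$, sets $\nu'_l=\nu_l[x\mapsto d^{w_l}_{i_l}\text{ for }x\in Y]$ ($l=0,1$), and picks $l$ and $i'_l>i_l$ in $w_l$. (2) Duplicator picks $i'_{1-l}>i_{1-l}$; Spoiler wins unless $(i'_0,\nu'_0),(i'_1,\nu'_1)$ agree. (3) Spoiler either continues with $\mathrm{TG}^{n,\mathcal{I}}_{k-1}(w_0,i'_0,\nu'_0,w_1,i'_1,\nu'_1)$,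 or (4) picks $i''_{1-l}$ strictly between $i_{1-l}$ and $i'_{1-l}$, and Duplicator must pick $i''_l$ strictly between $i_l$ and $i'_l$ with $(i''_0,\nu'_0),(i''_1,\nu'_1)$ agreeing, else Spoiler wins; then (5) play continues with $\mathrm{TG}^{n,\mathcal{I}}_{k-1}(w_0,i''_0,\nu'_0,w_1,i''_1,\nu'_1)$. Duplicator has a winning strategy if she can avoid Spoiler winning in every round. -}

module Defs where

open import Data.Nat using (ℕ; zero; suc; _<_; _≤_)
open import Data.Nat as ℕ using ()
open import Data.Integer as ℤ using (ℤ; +_)
open import Data.Fin using (Fin)
open import Data.Fin.Subset using (Subset)
open import Data.Bool using (Bool; true; false; if_then_else_)
open import Data.Vec using (lookup)
open import Data.List using (List)
open import Data.List.Membership.Propositional using () renaming (_∈_ to _∈ₗ_)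
open import Data.Product using (Σ; _×_; ∃)
open import Data.Unit using (⊤)
open import Data.Empty using (⊥)
open import Relation.Nullary using (¬_)
open import Function.Bundles using (_⇔_)
open import Data.Fin.Subset using () renaming (_∈_ to _∈ₛ_)

Word : ℕ → Set
Word m = ℕ → Subset m × ℕ

props : ∀ {m} → Word m → ℕ → Subset m
props w i = Data.Product.proj₁ (w i)

dat : ∀ {m} → Word m → ℕ → ℕ
dat w i = Data.Product.proj₂ (w i)

Val : ℕ → Set
Val n = Fin n → ℕ

upd : ∀ {n} → Val n → Subset n → ℕ → Val n
upd ν Y d x = if lookup Y x then d else ν x

ν₀ : ∀ {m n} → Word m → Val n
ν₀ w x = dat w 0

data Endpoint : Set where
  -∞ +∞ : Endpoint
  fin  : ℤ → Endpoint

record Interval : Set where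
  constructor interval
  field
    lo       : Endpoint
    loClosed : Bool
    hi       : Endpoint
    hiClosed : Bool

AboveLo : Endpoint → Bool → ℤ → Set
AboveLo -∞      _     z = ⊤
AboveLo +∞      _     z = ⊥
AboveLo (fin a) true  z = a ℤ.≤ z
AboveLo (fin a) false z = a ℤ.< z

BelowHi : Endpoint → Bool → ℤ → Set
BelowHi -∞      _     z = ⊥
BelowHi +∞      _     z = ⊤
BelowHi (fin b) true  z = z ℤ.≤ b
BelowHi (fin b) false z = z ℤ.< b

_∈I_ : ℤ → Interval → Set
z ∈I interval a ca b cb = AboveLo a ca z × BelowHi b cb z

-- FCons(ℤ): 𝓘 = S ∪ {±∞} with S ⊆ ℤ finite, represented by a list S.

EndpointIn : List ℤ → Endpoint → Set
EndpointIn S -∞      = ⊤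
EndpointIn S +∞      = ⊤
EndpointIn S (fin z) = z ∈ₗ S

IntervalIn : List ℤ → Interval → Set
IntervalIn S (interval a _ b _) = EndpointIn S a × EndpointIn S b

infixr 6 _∧_
infixr 5 _U_

data Formula (m n : ℕ) : Set where
  prop : Fin m → Formula m n
  _∈ᵣ_ : Fin n → Interval → Formula m n
  ¬ᶠ_  : Formula m n → Formula m n
  _∧_  : Formula m n → Formula m n → Formula m n
  _U_  : Formula m n → Formula m n → Formula m n
  bind : Fin n → Formula m n → Formula m n

urk : ∀ {m n} → Formula m n → ℕ
urk (prop p)   = 0
urk (x ∈ᵣ I)   = 0
urk (¬ᶠ φ)     = urk φ
urk (φ ∧ ψ)    = urk φ ℕ.⊔ urk ψ
urk (φ U ψ)    = suc (urk φ ℕ.⊔ urk ψ)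
urk (bind x φ) = urk φ

EndpointsIn : ∀ {m n} → List ℤ → Formula m n → Set
EndpointsIn S (prop p)   = ⊤
EndpointsIn S (x ∈ᵣ I)   = IntervalIn S I
EndpointsIn S (¬ᶠ φ)     = EndpointsIn S φ
EndpointsIn S (φ ∧ ψ)    = EndpointsIn S φ × EndpointsIn S ψ
EndpointsIn S (φ U ψ)    = EndpointsIn S φ × EndpointsIn S ψ
EndpointsIn S (bind x φ) = EndpointsIn S φ

-- membership in TPTL^{n,𝓘}_k (registers among x₁..xₙ by the type)
InTPTL : ∀ {m n} → List ℤ → ℕ → Formula m n → Set
InTPTL S k φ = urk φ ≤ k × EndpointsIn S φ

Sat : ∀ {m n} → Word m → ℕ → Val n → Formula m n → Set
Sat w i ν (prop p)   = p ∈ₛ props w i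
Sat w i ν (x ∈ᵣ I)   = ((+ dat w i) ℤ.- (+ ν x)) ∈I I
Sat w i ν (¬ᶠ φ)     = ¬ Sat w i ν φ
Sat w i ν (φ ∧ ψ)    = Sat w i ν φ × Sat w i ν ψ
Sat w i ν (φ U ψ)    =
  Σ ℕ λ j → i < j × Sat w j ν ψ × (∀ k → i < k → k < j → Sat w k ν φ)
Sat w i ν (bind x φ) = Sat w i (upd ν (Data.Vec.replicate _ false Data.Vec.[ x ]≔ true) (dat w i)) φ

_⊨_ : ∀ {m n} → Word m → Formula m n → Set
w ⊨ φ = Sat w 0 (ν₀ w) φ

Definable : ∀ {m} → (Word m → Set) → (n : ℕ) → List ℤ → ℕ → Set
Definable {m} L n S k =
  Σ (Formula m n) λ φ → InTPTL S k φ × (∀ w → (w ⊨ φ) ⇔ L w)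

Agree : ∀ {m n} → List ℤ → Word m → ℕ → Val n → Word m → ℕ → Val n → Set
Agree {m} {n} S w₀ i₀ ν₀' w₁ i₁ ν₁' =
  (∀ (p : Fin m) → Sat w₀ i₀ ν₀' (prop {n = n} p) ⇔ Sat w₁ i₁ ν₁' (prop {n = n} p)) ×
  (∀ (x : Fin n) (I : Interval) → IntervalIn S I →
     Sat w₀ i₀ ν₀' (_∈ᵣ_ {m = m} x I) ⇔ Sat w₁ i₁ ν₁' (_∈ᵣ_ {m = m} x I))

-- Duplicator has a winning strategy in TG^{n,𝓘}_k(w₀,i₀,ν₀,w₁,i₁,ν₁).
-- (The game has finite depth, so the existence of a winning strategy for
-- Duplicator is the alternating ∀/∃ condition over Spoiler/Duplicator moves.)
DupWins : ∀ {m n} → List ℤ → ℕ → Word m → ℕ → Val n → Word m → ℕ → Val n → Set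
DupWins S zero    w₀ i₀ ν₀' w₁ i₁ ν₁' = Agree S w₀ i₀ ν₀' w₁ i₁ ν₁'
DupWins {n = n} S (suc k) w₀ i₀ ν₀' w₁ i₁ ν₁' =
  Agree S w₀ i₀ ν₀' w₁ i₁ ν₁' ×
  (∀ (Y : Subset n) →
    let μ₀ = upd ν₀' Y (dat w₀ i₀)
        μ₁ = upd ν₁' Y (dat w₁ i₁)
    in
    -- Spoiler plays in w₀ (l = 0)
    (∀ j₀ → i₀ < j₀ → Σ ℕ λ j₁ → i₁ < j₁ ×
       Agree S w₀ j₀ μ₀ w₁ j₁ μ₁ ×
       DupWins S k w₀ j₀ μ₀ w₁ j₁ μ₁ ×
       (∀ h₁ → i₁ < h₁ → h₁ < j₁ → Σ ℕ λ h₀ → i₀ < h₀ × h₀ < j₀ ×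
          Agree S w₀ h₀ μ₀ w₁ h₁ μ₁ × DupWins S k w₀ h₀ μ₀ w₁ h₁ μ₁)) ×
    -- Spoiler plays in w₁ (l = 1)
    (∀ j₁ → i₁ < j₁ → Σ ℕ λ j₀ → i₀ < j₀ ×
       Agree S w₀ j₀ μ₀ w₁ j₁ μ₁ ×
       DupWins S k w₀ j₀ μ₀ w₁ j₁ μ₁ ×
       (∀ h₀ → i₀ < h₀ → h₀ < j₀ → Σ ℕ λ h₁ → i₁ < h₁ × h₁ < j₁ ×
          Agree S w₀ h₀ μ₀ w₁ h₁ μ₁ × DupWins S k w₀ h₀ μ₀ w₁ h₁ μ₁)))

-- Soundness: Duplicator's winning strategy in TG_k preserves the truth of every
-- TPTL_k formula, by induction on the formula. For x.φ one uses that rebinding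
-- registers to the current data value does not affect who wins; for φ U ψ,
-- Spoiler binds nothing, jumps to the witness of ψ and challenges the positions
-- in between, and Duplicator's answers carry the truth of ψ and φ over.
--
-- Completeness (classical): define finite lists Φ k of TPTL_k formulas, the
-- atoms together with, for k + 1, all formulas Y.(⋁ T U χ τ) saying "after
-- binding Y, some later position has Φ k-type τ and every position in between
-- has a Φ k-type in T". Positions with the same Φ k-type are won by Duplicator,
-- so if no pair w₀ ∈ L, w₁ ∉ L is won by her, L is a union of Φ k-types of
-- initial positions and is defined by the disjunction of their characteristic
-- formulas.

module Submission where

open import Defs
open import Level using (Level; 0ℓ)
open import Axiom.ExcludedMiddle using (ExcludedMiddle)
open import Data.Nat using (ℕ; zero; suc; _≤_; _<_; s≤s; z≤n)
open import Data.Nat.Properties using (⊔-lub; m⊔n≤o⇒m≤o; m⊔n≤o⇒n≤o)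
open import Data.Integer as ℤ using (ℤ; +_; 0ℤ)
open import Data.Integer.Properties using (+-inverseʳ)
open import Data.Bool using (Bool; true; false; if_then_else_; _∨_)
open import Data.Fin using (Fin; zero; suc)
open import Data.Fin.Subset using (Subset; ⊥; _∪_; ⋃)
open import Data.Fin.Subset.Properties using (∪-identityˡ)
open import Data.Vec using ([]; _∷_; lookup; replicate; _[_]≔_)
open import Data.Vec.Properties using (lookup-replicate; lookup-zipWith; ∷-injective; ∷-injectiveˡ; ∷-injectiveʳ)
open import Data.List using (List; []; _∷_; [_]; _++_; map; foldr; filter; length; allFin; cartesianProduct; cartesianProductWith)
open import Data.List.Membership.Propositional using (_∈_)
open import Data.List.Membership.Propositional.Properties
  using (∈-map⁺; ∈-map⁻; ∈-++⁺ˡ; ∈-++⁺ʳ; ∈-allFin; ∈-filter⁺; ∈-filter⁻;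
         ∈-cartesianProduct⁺; ∈-cartesianProduct⁻; ∈-cartesianProductWith⁺; ∈-cartesianProductWith⁻)
open import Data.List.Relation.Unary.Any using (here; there)
open import Data.List.Relation.Unary.Any.Properties using (∷↔)
open import Data.List.Relation.Unary.All as All using (All; []; _∷_)
open import Data.List.Relation.Unary.All.Properties using (++⁺; map⁺; tabulate⁺)
open import Data.Product using (Σ; _×_; _,_; proj₁; proj₂; uncurry)
open import Data.Product.Function.NonDependent.Propositional using (_×-⇔_)
open import Data.Sum using (_⊎_; inj₁; inj₂)
open import Data.Sum.Function.Propositional using (_⊎-⇔_)
open import Data.Unit using (tt)
open import Data.Empty using (⊥-elim)
open import Relation.Nullary using (¬_; yes; no; does)
open import Relation.Nullary.Decidable using (decidable-stable)
open import Relation.Unary using (Pred; Decidable)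
open import Relation.Binary.PropositionalEquality
  using (_≡_; _≗_; refl; sym; trans; cong; cong₂; subst; subst₂; module ≡-Reasoning)
open import Function.Bundles using (_⇔_; mk⇔; Equivalence)
open import Function.Properties.Inverse using (↔⇒⇔)
import Function.Properties.Equivalence as ⇔

open Equivalence

private variable
  a : Level
  A : Set a
  m n r k : ℕ
  S : List ℤ
  d : ℕ
  i i₀ i₁ : ℕ
  w w₀ w₁ : Word m
  u u' u₀ u₁ u₀' u₁' : Val n
  Y Y' : Subset n
  x : Fin n
  I : Interval
  φ ψ : Formula m n

bools : List Bool
bools = true ∷ false ∷ []

∈-bools : (b : Bool) → b ∈ bools
∈-bools true = here refl
∈-bools false = there (here refl)

allSubsets : (r : ℕ) → List (Subset r)
allSubsets zero = [ [] ]
allSubsets (suc r) = cartesianProductWith _∷_ bools (allSubsets r)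

∈-allSubsets : (Y : Subset r) → Y ∈ allSubsets r
∈-allSubsets [] = here refl
∈-allSubsets (b ∷ Y) = ∈-cartesianProductWith⁺ _∷_ (∈-bools b) (∈-allSubsets Y)

sublists : List A → List (List A)
sublists [] = [ [] ]
sublists (x ∷ xs) = map (x ∷_) (sublists xs) ++ sublists xs

filter-∈-sublists : {P : Pred A a} (P? : Decidable P) (xs : List A) → filter P? xs ∈ sublists xs
filter-∈-sublists P? [] = here refl
filter-∈-sublists P? (x ∷ xs) with does (P? x)
... | true = ∈-++⁺ˡ (∈-map⁺ (x ∷_) (filter-∈-sublists P? xs))
... | false = ∈-++⁺ʳ _ (filter-∈-sublists P? xs)

single : Fin r → Subset r
single x = replicate _ false [ x ]≔ true

upd-∈ : ∀ {u : Val n} {Y d x} → lookup Y x ≡ true → upd u Y d x ≡ d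
upd-∈ {u = u} {d = d} {x = x} Yx = cong (if_then d else u x) Yx

upd-∉ : ∀ {u : Val n} {Y d x} → lookup Y x ≡ false → upd u Y d x ≡ u x
upd-∉ {u = u} {d = d} {x = x} Yx = cong (if_then d else u x) Yx

upd-cong : u ≗ u' → upd u Y d ≗ upd u' Y d
upd-cong {Y = Y} e x with lookup Y x
... | true = refl
... | false = e x

upd-⊥ : ∀ (u : Val n) d → upd u ⊥ d ≗ u
upd-⊥ u d x = upd-∉ {u = u} {Y = ⊥} {d} (lookup-replicate x false)

upd-upd : ∀ (u : Val n) Y Y' d → upd (upd u Y d) Y' d ≗ upd u (Y ∪ Y') d
upd-upd u Y Y' d x rewrite lookup-zipWith _∨_ x Y Y' with lookup Y x | lookup Y' x
... | true | true = refl
... | true | false = refl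
... | false | _ = refl

Sat-cong : (φ : Formula m n) → u ≗ u' → Sat w i u φ → Sat w i u' φ
Sat-cong (prop p) e s = s
Sat-cong {w = w} {i = i} (x ∈ᵣ I) e s = subst (λ c → (+ dat w i ℤ.- + c) ∈I I) (e x) s
Sat-cong (¬ᶠ φ) e s t = s (Sat-cong φ (λ x → sym (e x)) t)
Sat-cong (φ ∧ ψ) e (s , t) = Sat-cong φ e s , Sat-cong ψ e t
Sat-cong (φ U ψ) e (j , i<j , s , t) = j , i<j , Sat-cong ψ e s , λ h i<h h<j → Sat-cong φ e (t h i<h h<j)
Sat-cong {w = w} {i = i} (bind x φ) e s = Sat-cong φ (upd-cong {Y = single x} {d = dat w i} e) s

Sat-cong-⇔ : (φ : Formula m n) → u ≗ u' → Sat w i u φ ⇔ Sat w i u' φ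
Sat-cong-⇔ φ e = mk⇔ (Sat-cong φ e) (Sat-cong φ (λ x → sym (e x)))

Sat-∈ᵣ-value : ∀ {c} → u x ≡ c → Sat w i u (x ∈ᵣ I) ≡ (+ dat w i ℤ.- + c) ∈I I
Sat-∈ᵣ-value {w = w} {i = i} {I = I} e = cong (λ c → (+ dat w i ℤ.- + c) ∈I I) e

Sat-∈ᵣ-self : u x ≡ dat w i → Sat w i u (x ∈ᵣ I) ≡ 0ℤ ∈I I
Sat-∈ᵣ-self {u = u} {x = x} {w = w} {i = i} {I = I} e =
  trans (Sat-∈ᵣ-value {u = u} {x = x} {w = w} {i = i} e) (cong (_∈I I) (+-inverseʳ (+ dat w i)))

Agree-sym : Agree S w₀ i₀ u₀ w₁ i₁ u₁ → Agree S w₁ i₁ u₁ w₀ i₀ u₀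
Agree-sym (agree-props , agree-regs) = (λ p → ⇔.sym (agree-props p)) , λ x I I∈ → ⇔.sym (agree-regs x I I∈)

Agree-rebind : Agree S w₀ i₀ u₀ w₁ i₁ u₁ →
  u₀' ≗ upd u₀ Y (dat w₀ i₀) → u₁' ≗ upd u₁ Y (dat w₁ i₁) → Agree S w₀ i₀ u₀' w₁ i₁ u₁'
Agree-rebind {S = S} {w₀ = w₀} {i₀ = i₀} {u₀ = u₀} {w₁ = w₁} {i₁ = i₁} {u₁ = u₁}
             {u₀' = u₀'} {Y = Y} {u₁' = u₁'}
  (agree-props , agree-regs) e₀ e₁ = agree-props , agree-regs′
  where
  agree-regs′ : ∀ x I → IntervalIn S I → Sat w₀ i₀ u₀' (x ∈ᵣ I) ⇔ Sat w₁ i₁ u₁' (x ∈ᵣ I)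
  agree-regs′ x I I∈ with lookup Y x in Yx
  ... | true = subst₂ _⇔_
    (sym (Sat-∈ᵣ-self {u = u₀'} {w = w₀} {I = I} (trans (e₀ x) (upd-∈ {u = u₀} {Y = Y} Yx))))
    (sym (Sat-∈ᵣ-self {u = u₁'} {w = w₁} {I = I} (trans (e₁ x) (upd-∈ {u = u₁} {Y = Y} Yx))))
    ⇔.refl
  ... | false = subst₂ _⇔_
    (sym (Sat-∈ᵣ-value {u = u₀'} {w = w₀} {I = I} (trans (e₀ x) (upd-∉ {u = u₀} {Y = Y} Yx))))
    (sym (Sat-∈ᵣ-value {u = u₁'} {w = w₁} {I = I} (trans (e₁ x) (upd-∉ {u = u₁} {Y = Y} Yx))))
    (agree-regs x I I∈)

DupWins⇒Agree : ∀ k → DupWins S k w₀ i₀ u₀ w₁ i₁ u₁ → Agree S w₀ i₀ u₀ w₁ i₁ u₁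
DupWins⇒Agree zero agree = agree
DupWins⇒Agree (suc k) (agree , _) = agree

DupWins-sym : ∀ k → DupWins S k w₀ i₀ u₀ w₁ i₁ u₁ → DupWins S k w₁ i₁ u₁ w₀ i₀ u₀
DupWins-sym {w₀ = w₀} {i₀ = i₀} {u₀ = u₀} {w₁ = w₁} {i₁ = i₁} {u₁ = u₁} zero agree =
  Agree-sym {w₀ = w₀} {i₀ = i₀} {u₀ = u₀} {w₁ = w₁} {i₁ = i₁} {u₁ = u₁} agree
DupWins-sym {w₀ = w₀} {i₀ = i₀} {u₀ = u₀} {w₁ = w₁} {i₁ = i₁} {u₁ = u₁} (suc k) (agree , game) =
  Agree-sym {w₀ = w₀} {i₀ = i₀} {u₀ = u₀} {w₁ = w₁} {i₁ = i₁} {u₁ = u₁} agree , λ Y →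
  (λ j₁ i₁<j₁ → let (j₀ , i₀<j₀ , _ , winsʲ , between) = proj₂ (game Y) j₁ i₁<j₁ in
     j₀ , i₀<j₀ , DupWins⇒Agree k (DupWins-sym k winsʲ) , DupWins-sym k winsʲ , λ h₀ i₀<h₀ h₀<j₀ →
       let (h₁ , i₁<h₁ , h₁<j₁ , _ , winsʰ) = between h₀ i₀<h₀ h₀<j₀ in
       h₁ , i₁<h₁ , h₁<j₁ , DupWins⇒Agree k (DupWins-sym k winsʰ) , DupWins-sym k winsʰ) ,
  (λ j₀ i₀<j₀ → let (j₁ , i₁<j₁ , _ , winsʲ , between) = proj₁ (game Y) j₀ i₀<j₀ in
     j₁ , i₁<j₁ , DupWins⇒Agree k (DupWins-sym k winsʲ) , DupWins-sym k winsʲ , λ h₁ i₁<h₁ h₁<j₁ →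
       let (h₀ , i₀<h₀ , h₀<j₀ , _ , winsʰ) = between h₁ i₁<h₁ h₁<j₁ in
       h₀ , i₀<h₀ , h₀<j₀ , DupWins⇒Agree k (DupWins-sym k winsʰ) , DupWins-sym k winsʰ)

-- Rebinding registers to the current data values does not hurt Duplicator:
-- Spoiler's later choice Y' in the new game is the choice Y ∪ Y' in the old one.
DupWins-rebind : ∀ k → DupWins S k w₀ i₀ u₀ w₁ i₁ u₁ →
  u₀' ≗ upd u₀ Y (dat w₀ i₀) → u₁' ≗ upd u₁ Y (dat w₁ i₁) → DupWins S k w₀ i₀ u₀' w₁ i₁ u₁'

DupWins-cong : ∀ k → DupWins S k w₀ i₀ u₀ w₁ i₁ u₁ →
  u₀' ≗ u₀ → u₁' ≗ u₁ → DupWins S k w₀ i₀ u₀' w₁ i₁ u₁'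
DupWins-cong {u₀ = u₀} {u₁ = u₁} k wins e₀ e₁ =
  DupWins-rebind {Y = ⊥} k wins
    (λ x → trans (e₀ x) (sym (upd-⊥ u₀ _ x))) (λ x → trans (e₁ x) (sym (upd-⊥ u₁ _ x)))

DupWins-rebind {w₀ = w₀} {i₀ = i₀} {w₁ = w₁} {i₁ = i₁} {Y = Y} zero agree e₀ e₁ =
  Agree-rebind {w₀ = w₀} {i₀ = i₀} {w₁ = w₁} {i₁ = i₁} {Y = Y} agree e₀ e₁
DupWins-rebind {w₀ = w₀} {i₀ = i₀} {u₀ = u₀} {w₁ = w₁} {i₁ = i₁} {u₁ = u₁} {u₀' = u₀'} {Y = Y} {u₁' = u₁'}
               (suc k) (agree , game) e₀ e₁ =
  Agree-rebind {w₀ = w₀} {i₀ = i₀} {w₁ = w₁} {i₁ = i₁} {Y = Y} agree e₀ e₁ , λ Y' →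
  (λ j₀ i₀<j₀ → let (j₁ , i₁<j₁ , _ , winsʲ , between) = proj₁ (game (Y ∪ Y')) j₀ i₀<j₀ in
     j₁ , i₁<j₁ , DupWins⇒Agree k (merge Y' winsʲ) , merge Y' winsʲ , λ h₁ i₁<h₁ h₁<j₁ →
       let (h₀ , i₀<h₀ , h₀<j₀ , _ , winsʰ) = between h₁ i₁<h₁ h₁<j₁ in
       h₀ , i₀<h₀ , h₀<j₀ , DupWins⇒Agree k (merge Y' winsʰ) , merge Y' winsʰ) ,
  (λ j₁ i₁<j₁ → let (j₀ , i₀<j₀ , _ , winsʲ , between) = proj₂ (game (Y ∪ Y')) j₁ i₁<j₁ in
     j₀ , i₀<j₀ , DupWins⇒Agree k (merge Y' winsʲ) , merge Y' winsʲ , λ h₀ i₀<h₀ h₀<j₀ →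
       let (h₁ , i₁<h₁ , h₁<j₁ , _ , winsʰ) = between h₀ i₀<h₀ h₀<j₀ in
       h₁ , i₁<h₁ , h₁<j₁ , DupWins⇒Agree k (merge Y' winsʰ) , merge Y' winsʰ)
  where
  merge : ∀ Y' {j₀ j₁} →
    DupWins S k w₀ j₀ (upd u₀ (Y ∪ Y') (dat w₀ i₀)) w₁ j₁ (upd u₁ (Y ∪ Y') (dat w₁ i₁)) →
    DupWins S k w₀ j₀ (upd u₀' Y' (dat w₀ i₀)) w₁ j₁ (upd u₁' Y' (dat w₁ i₁))
  merge Y' wins = DupWins-cong k wins
    (λ x → trans (upd-cong {Y = Y'} e₀ x) (upd-upd u₀ Y Y' _ x))
    (λ x → trans (upd-cong {Y = Y'} e₁ x) (upd-upd u₁ Y Y' _ x))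

DupWins⇒Sat : ∀ k (φ : Formula m n) → InTPTL S k φ →
  DupWins S k w₀ i₀ u₀ w₁ i₁ u₁ → Sat w₀ i₀ u₀ φ → Sat w₁ i₁ u₁ φ
DupWins⇒Sat k (prop p) _ wins = to (proj₁ (DupWins⇒Agree k wins) p)
DupWins⇒Sat k (x ∈ᵣ I) (_ , I∈) wins = to (proj₂ (DupWins⇒Agree k wins) x I I∈)
DupWins⇒Sat k (¬ᶠ φ) φ∈ wins ¬s s = ¬s (DupWins⇒Sat k φ φ∈ (DupWins-sym k wins) s)
DupWins⇒Sat k (φ ∧ ψ) (r , φ∈ , ψ∈) wins (s , t) =
  DupWins⇒Sat k φ (m⊔n≤o⇒m≤o _ _ r , φ∈) wins s , DupWins⇒Sat k ψ (m⊔n≤o⇒n≤o _ _ r , ψ∈) wins t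
DupWins⇒Sat k (bind x φ) φ∈ wins =
  DupWins⇒Sat k φ φ∈ (DupWins-rebind {Y = single x} k wins (λ _ → refl) (λ _ → refl))
DupWins⇒Sat zero (φ U ψ) (() , _)
DupWins⇒Sat {S = S} {w₀ = w₀} {i₀ = i₀} {u₀ = u₀} {w₁ = w₁} {i₁ = i₁} {u₁ = u₁}
            (suc k) (φ U ψ) (s≤s r , φ∈ , ψ∈) (_ , game) (j₀ , i₀<j₀ , sψ , sφ) =
  let (j₁ , i₁<j₁ , _ , winsʲ , between) = proj₁ (game ⊥) j₀ i₀<j₀ in
  j₁ , i₁<j₁ , DupWins⇒Sat k ψ (m⊔n≤o⇒n≤o _ _ r , ψ∈) (unbind winsʲ) sψ , λ h₁ i₁<h₁ h₁<j₁ →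
    let (h₀ , i₀<h₀ , h₀<j₀ , _ , winsʰ) = between h₁ i₁<h₁ h₁<j₁ in
    DupWins⇒Sat k φ (m⊔n≤o⇒m≤o _ _ r , φ∈) (unbind winsʰ) (sφ h₀ i₀<h₀ h₀<j₀)
  where
  unbind : ∀ {j₀ j₁} → DupWins S k w₀ j₀ (upd u₀ ⊥ (dat w₀ i₀)) w₁ j₁ (upd u₁ ⊥ (dat w₁ i₁)) →
    DupWins S k w₀ j₀ u₀ w₁ j₁ u₁
  unbind wins = DupWins-cong k wins (λ x → sym (upd-⊥ u₀ _ x)) (λ x → sym (upd-⊥ u₁ _ x))

members : Subset r → List (Fin r)
members [] = []
members (true ∷ Y) = zero ∷ map suc (members Y)
members (false ∷ Y) = map suc (members Y)

⋃-single-suc : (xs : List (Fin r)) → ⋃ (map single (map suc xs)) ≡ false ∷ ⋃ (map single xs)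
⋃-single-suc [] = refl
⋃-single-suc (x ∷ xs) = cong (single (suc x) ∪_) (⋃-single-suc xs)

⋃-single-members : (Y : Subset r) → ⋃ (map single (members Y)) ≡ Y
⋃-single-members [] = refl
⋃-single-members (true ∷ Y) = begin
  single zero ∪ ⋃ (map single (map suc (members Y)))  ≡⟨ cong (single zero ∪_) (⋃-single-suc (members Y)) ⟩
  true ∷ (⊥ ∪ ⋃ (map single (members Y)))            ≡⟨ cong (true ∷_) (∪-identityˡ _) ⟩
  true ∷ ⋃ (map single (members Y))                  ≡⟨ cong (true ∷_) (⋃-single-members Y) ⟩
  true ∷ Y                                           ∎
  where open ≡-Reasoning
⋃-single-members (false ∷ Y) = trans (⋃-single-suc (members Y)) (cong (false ∷_) (⋃-single-members Y))

bindAll : Subset n → Formula m n → Formula m n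
bindAll Y φ = foldr bind φ (members Y)

Sat-foldr-bind : ∀ (xs : List (Fin n)) → Sat w i u (foldr bind φ xs) ⇔ Sat w i (upd u (⋃ (map single xs)) (dat w i)) φ
Sat-foldr-bind {w = w} {i = i} {u = u} {φ = φ} [] = Sat-cong-⇔ φ (λ x → sym (upd-⊥ u (dat w i) x))
Sat-foldr-bind {w = w} {i = i} {u = u} {φ = φ} (x ∷ xs) =
  ⇔.trans (Sat-foldr-bind xs) (Sat-cong-⇔ φ (upd-upd u (single x) (⋃ (map single xs)) (dat w i)))

Sat-bindAll : ∀ Y → Sat w i u (bindAll Y φ) ⇔ Sat w i (upd u Y (dat w i)) φ
Sat-bindAll {w = w} {i = i} {u = u} {φ = φ} Y =
  subst (λ Z → Sat w i u (bindAll Y φ) ⇔ Sat w i (upd u Z (dat w i)) φ) (⋃-single-members Y) (Sat-foldr-bind (members Y))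

endpoints : List ℤ → List Endpoint
endpoints S = -∞ ∷ +∞ ∷ map fin S

∈-endpoints : ∀ e → EndpointIn S e → e ∈ endpoints S
∈-endpoints -∞ _ = here refl
∈-endpoints +∞ _ = there (here refl)
∈-endpoints (fin z) z∈S = there (there (∈-map⁺ fin z∈S))

endpoints-In : ∀ {e} → e ∈ endpoints S → EndpointIn S e
endpoints-In (here refl) = tt
endpoints-In (there (here refl)) = tt
endpoints-In (there (there e∈)) with ∈-map⁻ fin e∈
... | z , z∈S , refl = z∈S

bounds : List ℤ → List (Endpoint × Bool)
bounds S = cartesianProduct (endpoints S) bools

intervalFrom : Endpoint × Bool → Endpoint × Bool → Interval
intervalFrom (a , ca) (b , cb) = interval a ca b cb

intervals : List ℤ → List Interval
intervals S = cartesianProductWith intervalFrom (bounds S) (bounds S)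

∈-intervals : ∀ I → IntervalIn S I → I ∈ intervals S
∈-intervals (interval a ca b cb) (a∈ , b∈) = ∈-cartesianProductWith⁺ intervalFrom
  (∈-cartesianProduct⁺ (∈-endpoints a a∈) (∈-bools ca)) (∈-cartesianProduct⁺ (∈-endpoints b b∈) (∈-bools cb))

intervals-In : I ∈ intervals S → IntervalIn S I
intervals-In {S = S} I∈ with ∈-cartesianProductWith⁻ intervalFrom (bounds S) (bounds S) I∈
... | _ , _ , lo∈ , hi∈ , refl =
  endpoints-In (proj₁ (∈-cartesianProduct⁻ (endpoints S) bools lo∈)) ,
  endpoints-In (proj₁ (∈-cartesianProduct⁻ (endpoints S) bools hi∈))

atoms : List ℤ → List (Formula m n)
atoms S = map prop (allFin _) ++ cartesianProductWith _∈ᵣ_ (allFin _) (intervals S)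

InTPTL-atoms : ∀ k → All (InTPTL {m} {n} S k) (atoms S)
InTPTL-atoms {S = S} k = ++⁺ (map⁺ (tabulate⁺ λ _ → z≤n , tt)) (All.tabulate register)
  where
  register : φ ∈ cartesianProductWith _∈ᵣ_ (allFin _) (intervals S) → InTPTL S k φ
  register φ∈ with ∈-cartesianProductWith⁻ _∈ᵣ_ (allFin _) (intervals S) φ∈
  ... | _ , _ , _ , I∈ , refl = z≤n , intervals-In I∈

InTPTL-∧ : ∀ (φ ψ : Formula m n) → InTPTL S k φ → InTPTL S k ψ → InTPTL S k (φ ∧ ψ)
InTPTL-∧ _ _ (rφ , eφ) (rψ , eψ) = ⊔-lub rφ rψ , eφ , eψ

InTPTL-U : ∀ (φ ψ : Formula m n) → InTPTL S k φ → InTPTL S k ψ → InTPTL S (suc k) (φ U ψ)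
InTPTL-U _ _ (rφ , eφ) (rψ , eψ) = s≤s (⊔-lub rφ rψ) , eφ , eψ

InTPTL-foldr-bind : ∀ xs → InTPTL S k φ → InTPTL S k (foldr bind φ xs)
InTPTL-foldr-bind [] φ∈ = φ∈
InTPTL-foldr-bind (x ∷ xs) φ∈ = InTPTL-foldr-bind xs φ∈

module Completeness (em : ExcludedMiddle 0ℓ) {m n : ℕ} (S : List ℤ) (x₀ : Fin n) where

  -- No integer lies above +∞. Falsity needs a register; this is why 1 ≤ n.
  ⊥ᶠ : Formula m n
  ⊥ᶠ = x₀ ∈ᵣ interval +∞ true +∞ true

  _∨ᶠ_ : Formula m n → Formula m n → Formula m n
  φ ∨ᶠ ψ = ¬ᶠ (¬ᶠ φ ∧ ¬ᶠ ψ)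

  Sat-∨ᶠ : ∀ {w : Word m} {i u} φ ψ → Sat w i u (φ ∨ᶠ ψ) ⇔ (Sat w i u φ ⊎ Sat w i u ψ)
  Sat-∨ᶠ {w} {i} {u} φ ψ = mk⇔ from-¬¬ λ { (inj₁ s) (¬s , _) → ¬s s ; (inj₂ t) (_ , ¬t) → ¬t t }
    where
    from-¬¬ : Sat w i u (φ ∨ᶠ ψ) → Sat w i u φ ⊎ Sat w i u ψ
    from-¬¬ ¬both with em {Sat w i u φ}
    ... | yes s = inj₁ s
    ... | no ¬s = inj₂ (decidable-stable em λ ¬t → ¬both (¬s , ¬t))

  lit : Formula m n → Bool → Formula m n
  lit φ true = φ
  lit φ false = ¬ᶠ φ

  tp : (Ψ : List (Formula m n)) → Word m → ℕ → Val n → Subset (length Ψ)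
  tp [] w i u = []
  tp (φ ∷ Ψ) w i u = does (em {Sat w i u φ}) ∷ tp Ψ w i u

  χ : (Ψ : List (Formula m n)) → Subset (length Ψ) → Formula m n
  χ [] [] = ¬ᶠ ⊥ᶠ
  χ (φ ∷ Ψ) (b ∷ σ) = lit φ b ∧ χ Ψ σ

  typeIn : (Ψ : List (Formula m n)) → List (Subset (length Ψ)) → Formula m n
  typeIn Ψ [] = ⊥ᶠ
  typeIn Ψ (σ ∷ T) = χ Ψ σ ∨ᶠ typeIn Ψ T

  Sat-lit : ∀ {w : Word m} {i u} φ b → Sat w i u (lit φ b) ⇔ (does (em {Sat w i u φ}) ≡ b)
  Sat-lit {w} {i} {u} φ b with em {Sat w i u φ} | b
  ... | yes s | true = mk⇔ (λ _ → refl) (λ _ → s)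
  ... | yes s | false = mk⇔ (λ ¬s → ⊥-elim (¬s s)) λ ()
  ... | no ¬s | true = mk⇔ (λ s → ⊥-elim (¬s s)) λ ()
  ... | no ¬s | false = mk⇔ (λ _ → refl) (λ _ → ¬s)

  Sat-χ : ∀ {w : Word m} {i u} Ψ σ → Sat w i u (χ Ψ σ) ⇔ (tp Ψ w i u ≡ σ)
  Sat-χ [] [] = mk⇔ (λ _ → refl) (λ _ → proj₁)
  Sat-χ (φ ∷ Ψ) (b ∷ σ) = ⇔.trans (Sat-lit φ b ×-⇔ Sat-χ Ψ σ) (mk⇔ (uncurry (cong₂ _∷_)) ∷-injective)

  Sat-typeIn : ∀ {w : Word m} {i u} Ψ T → Sat w i u (typeIn Ψ T) ⇔ (tp Ψ w i u ∈ T)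
  Sat-typeIn Ψ [] = mk⇔ (λ ()) λ ()
  Sat-typeIn Ψ (σ ∷ T) =
    ⇔.trans (Sat-∨ᶠ (χ Ψ σ) (typeIn Ψ T)) (⇔.trans (Sat-χ Ψ σ ⊎-⇔ Sat-typeIn Ψ T) (↔⇒⇔ (∷↔ _)))

  tp-⇒ : ∀ {Ψ φ} {w₀ w₁ : Word m} {i₀ i₁ u₀ u₁} → tp Ψ w₀ i₀ u₀ ≡ tp Ψ w₁ i₁ u₁ →
    φ ∈ Ψ → Sat w₀ i₀ u₀ φ → Sat w₁ i₁ u₁ φ
  tp-⇒ {φ ∷ _} eq (here refl) s = from (Sat-lit φ true) (trans (sym (∷-injectiveˡ eq)) (to (Sat-lit φ true) s))
  tp-⇒ {_ ∷ _} eq (there φ∈) = tp-⇒ (∷-injectiveʳ eq) φ∈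

  types : (Ψ : List (Formula m n)) → List (Subset (length Ψ))
  types Ψ = allSubsets (length Ψ)

  untilFormula : (Ψ : List (Formula m n)) → Subset n → List (Subset (length Ψ)) → Subset (length Ψ) → Formula m n
  untilFormula Ψ Y T τ = bindAll Y (typeIn Ψ T U χ Ψ τ)

  untilFormulas : List (Formula m n) → List (Formula m n)
  untilFormulas Ψ = cartesianProductWith (λ Y → uncurry (untilFormula Ψ Y)) (allSubsets n)
    (cartesianProduct (sublists (types Ψ)) (types Ψ))

  Sat-untilFormula : ∀ {w : Word m} {i u} Ψ Y T τ → let μ = upd u Y (dat w i) in
    Sat w i u (untilFormula Ψ Y T τ) ⇔
      (Σ ℕ λ j → i < j × tp Ψ w j μ ≡ τ × (∀ h → i < h → h < j → tp Ψ w h μ ∈ T))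
  Sat-untilFormula Ψ Y T τ = ⇔.trans (Sat-bindAll Y) (mk⇔
    (λ (j , i<j , sτ , sT) → j , i<j , to (Sat-χ Ψ τ) sτ , λ h i<h h<j → to (Sat-typeIn Ψ T) (sT h i<h h<j))
    (λ (j , i<j , eτ , eT) → j , i<j , from (Sat-χ Ψ τ) eτ , λ h i<h h<j → from (Sat-typeIn Ψ T) (eT h i<h h<j)))

  InTPTL-⊥ᶠ : ∀ k → InTPTL S k ⊥ᶠ
  InTPTL-⊥ᶠ k = z≤n , tt , tt

  InTPTL-χ : ∀ {k Ψ} → All (InTPTL S k) Ψ → ∀ σ → InTPTL S k (χ Ψ σ)
  InTPTL-χ {k} [] [] = InTPTL-⊥ᶠ k
  InTPTL-χ {Ψ = φ ∷ Ψ} (φ∈ ∷ Ψ∈) (true ∷ σ) = InTPTL-∧ φ (χ Ψ σ) φ∈ (InTPTL-χ Ψ∈ σ)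
  InTPTL-χ {Ψ = φ ∷ Ψ} (φ∈ ∷ Ψ∈) (false ∷ σ) = InTPTL-∧ (¬ᶠ φ) (χ Ψ σ) φ∈ (InTPTL-χ Ψ∈ σ)

  InTPTL-typeIn : ∀ {k Ψ} → All (InTPTL S k) Ψ → ∀ T → InTPTL S k (typeIn Ψ T)
  InTPTL-typeIn {k} Ψ∈ [] = InTPTL-⊥ᶠ k
  InTPTL-typeIn {Ψ = Ψ} Ψ∈ (σ ∷ T) =
    InTPTL-∧ (¬ᶠ χ Ψ σ) (¬ᶠ typeIn Ψ T) (InTPTL-χ Ψ∈ σ) (InTPTL-typeIn Ψ∈ T)

  InTPTL-untilFormulas : ∀ {k Ψ} → All (InTPTL S k) Ψ → All (InTPTL S (suc k)) (untilFormulas Ψ)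
  InTPTL-untilFormulas {Ψ = Ψ} Ψ∈ = All.tabulate λ φ∈ →
    let (Y , (T , τ) , _ , _ , eq) = ∈-cartesianProductWith⁻ _ (allSubsets n) _ φ∈ in
    subst (InTPTL S _) (sym eq) (InTPTL-foldr-bind (members Y)
      (InTPTL-U (typeIn Ψ T) (χ Ψ τ) (InTPTL-typeIn Ψ∈ T) (InTPTL-χ Ψ∈ τ)))

  Φ : ℕ → List (Formula m n)
  Φ zero = atoms S
  Φ (suc k) = atoms S ++ untilFormulas (Φ k)

  InTPTL-Φ : ∀ k → All (InTPTL S k) (Φ k)
  InTPTL-Φ zero = InTPTL-atoms zero
  InTPTL-Φ (suc k) = ++⁺ (InTPTL-atoms (suc k)) (InTPTL-untilFormulas (InTPTL-Φ k))

  atoms⊆Φ : ∀ k {φ} → φ ∈ atoms S → φ ∈ Φ k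
  atoms⊆Φ zero φ∈ = φ∈
  atoms⊆Φ (suc k) φ∈ = ∈-++⁺ˡ φ∈

  tp≡⇒Agree : ∀ k {w₀ w₁ : Word m} {i₀ i₁ u₀ u₁} → tp (Φ k) w₀ i₀ u₀ ≡ tp (Φ k) w₁ i₁ u₁ →
    Agree S w₀ i₀ u₀ w₁ i₁ u₁
  tp≡⇒Agree k {w₀} {w₁} {i₀} {i₁} {u₀} {u₁} eq =
    (λ p → same (∈-++⁺ˡ (∈-map⁺ prop (∈-allFin p)))) ,
    (λ x I I∈ → same (∈-++⁺ʳ _ (∈-cartesianProductWith⁺ _∈ᵣ_ (∈-allFin x) (∈-intervals I I∈))))
    where
    same : ∀ {φ} → φ ∈ atoms S → Sat w₀ i₀ u₀ φ ⇔ Sat w₁ i₁ u₁ φ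
    same φ∈ = mk⇔ (tp-⇒ eq (atoms⊆Φ k φ∈)) (tp-⇒ (sym eq) (atoms⊆Φ k φ∈))

  untilFormulas⇒answer : ∀ Ψ {w₀ w₁ : Word m} {i₀ i₁ u₀ u₁} →
    (∀ {φ} → φ ∈ untilFormulas Ψ → Sat w₀ i₀ u₀ φ → Sat w₁ i₁ u₁ φ) →
    ∀ Y j₀ → i₀ < j₀ → let μ₀ = upd u₀ Y (dat w₀ i₀) ; μ₁ = upd u₁ Y (dat w₁ i₁) in
    Σ ℕ λ j₁ → i₁ < j₁ × tp Ψ w₀ j₀ μ₀ ≡ tp Ψ w₁ j₁ μ₁ ×
      (∀ h₁ → i₁ < h₁ → h₁ < j₁ → Σ ℕ λ h₀ → i₀ < h₀ × h₀ < j₀ × tp Ψ w₀ h₀ μ₀ ≡ tp Ψ w₁ h₁ μ₁)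
  -- Duplicator answers with the witness of the until formula whose τ is the type
  -- of Spoiler's position j₀ and whose T lists the types strictly between i₀ and j₀.
  untilFormulas⇒answer Ψ {w₀} {w₁} {i₀} {i₁} {u₀} {u₁} transfer Y j₀ i₀<j₀ =
    let (j₁ , i₁<j₁ , τ≡ , inT) = to (Sat-untilFormula Ψ Y T τ) (transfer φ∈ (from (Sat-untilFormula Ψ Y T τ)
          (j₀ , i₀<j₀ , refl , λ h i₀<h h<j₀ → ∈-filter⁺ between? (∈-allSubsets _) (h , i₀<h , h<j₀ , refl))))
    in j₁ , i₁<j₁ , sym τ≡ , λ h₁ i₁<h₁ h₁<j₁ →
         proj₂ (∈-filter⁻ between? {xs = types Ψ} (inT h₁ i₁<h₁ h₁<j₁))
    where
    μ₀ : Val n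
    μ₀ = upd u₀ Y (dat w₀ i₀)
    τ : Subset (length Ψ)
    τ = tp Ψ w₀ j₀ μ₀
    Between : Subset (length Ψ) → Set
    Between σ = Σ ℕ λ h → i₀ < h × h < j₀ × tp Ψ w₀ h μ₀ ≡ σ
    between? : Decidable Between
    between? σ = em
    T : List (Subset (length Ψ))
    T = filter between? (types Ψ)
    φ∈ : untilFormula Ψ Y T τ ∈ untilFormulas Ψ
    φ∈ = ∈-cartesianProductWith⁺ _ (∈-allSubsets Y)
      (∈-cartesianProduct⁺ (filter-∈-sublists between? (types Ψ)) (∈-allSubsets τ))

  tp≡⇒DupWins : ∀ k {w₀ w₁ : Word m} {i₀ i₁ u₀ u₁} → tp (Φ k) w₀ i₀ u₀ ≡ tp (Φ k) w₁ i₁ u₁ →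
    DupWins S k w₀ i₀ u₀ w₁ i₁ u₁
  tp≡⇒DupWins zero eq = tp≡⇒Agree zero eq
  tp≡⇒DupWins (suc k) eq = tp≡⇒Agree (suc k) eq , λ Y →
    (λ j₀ i₀<j₀ → let (j₁ , i₁<j₁ , e , between) = untilFormulas⇒answer (Φ k) (transfer eq) Y j₀ i₀<j₀ in
      j₁ , i₁<j₁ , tp≡⇒Agree k e , tp≡⇒DupWins k e , λ h₁ i₁<h₁ h₁<j₁ →
        let (h₀ , i₀<h₀ , h₀<j₀ , e′) = between h₁ i₁<h₁ h₁<j₁ in
        h₀ , i₀<h₀ , h₀<j₀ , tp≡⇒Agree k e′ , tp≡⇒DupWins k e′) ,
    (λ j₁ i₁<j₁ → let (j₀ , i₀<j₀ , e , between) = untilFormulas⇒answer (Φ k) (transfer (sym eq)) Y j₁ i₁<j₁ in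
      j₀ , i₀<j₀ , tp≡⇒Agree k (sym e) , tp≡⇒DupWins k (sym e) , λ h₀ i₀<h₀ h₀<j₀ →
        let (h₁ , i₁<h₁ , h₁<j₁ , e′) = between h₀ i₀<h₀ h₀<j₀ in
        h₁ , i₁<h₁ , h₁<j₁ , tp≡⇒Agree k (sym e′) , tp≡⇒DupWins k (sym e′))
    where
    transfer : ∀ {w₀ w₁ : Word m} {i₀ i₁ u₀ u₁} → tp (Φ (suc k)) w₀ i₀ u₀ ≡ tp (Φ (suc k)) w₁ i₁ u₁ →
      ∀ {φ} → φ ∈ untilFormulas (Φ k) → Sat w₀ i₀ u₀ φ → Sat w₁ i₁ u₁ φ
    transfer eq φ∈ = tp-⇒ eq (∈-++⁺ʳ (atoms S) φ∈)

  typeClosed⇒Definable : ∀ k (L : Word m → Set) →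
    (∀ w₀ w₁ → L w₀ → tp (Φ k) w₀ 0 (ν₀ w₀) ≡ tp (Φ k) w₁ 0 (ν₀ w₁) → L w₁) → Definable L n S k
  typeClosed⇒Definable k L closed = typeIn (Φ k) T , InTPTL-typeIn (InTPTL-Φ k) T , λ w →
    mk⇔ (λ w⊨ → let (w′ , Lw′ , eq) = proj₂ (∈-filter⁻ realised? {xs = types (Φ k)}
                                           (to (Sat-typeIn (Φ k) T) w⊨))
                 in closed w′ w Lw′ eq)
        (λ Lw → from (Sat-typeIn (Φ k) T) (∈-filter⁺ realised? (∈-allSubsets _) (w , Lw , refl)))
    where
    Realised : Subset (length (Φ k)) → Set
    Realised σ = Σ (Word m) λ w → L w × tp (Φ k) w 0 (ν₀ w) ≡ σ
    realised? : Decidable Realised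
    realised? σ = em
    T : List (Subset (length (Φ k)))
    T = filter realised? (types (Φ k))

theorem5 : ExcludedMiddle 0ℓ →
    ∀ {m : ℕ} (L : Word m → Set) (S : List ℤ) (n k : ℕ) → 1 ≤ n →
    (¬ Definable L n S k) ⇔
      (Σ (Word m) λ w₀ → Σ (Word m) λ w₁ → L w₀ × ¬ L w₁ ×
         DupWins {n = n} S k w₀ 0 (ν₀ w₀) w₁ 0 (ν₀ w₁))
theorem5 em L S (suc n) k _ = mk⇔
  (λ undefinable → decidable-stable em λ noPair → undefinable (typeClosed⇒Definable k L λ w₀ w₁ Lw₀ eq →
    decidable-stable em λ ¬Lw₁ → noPair (w₀ , w₁ , Lw₀ , ¬Lw₁ , tp≡⇒DupWins k eq)))
  (λ (w₀ , w₁ , Lw₀ , ¬Lw₁ , wins) (φ , φ∈ , defines) →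
    ¬Lw₁ (to (defines w₁) (DupWins⇒Sat k φ φ∈ wins (from (defines w₀) Lw₀))))
  where open Completeness em {n = suc n} S zero
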